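{- Let $p$ be an odd prime. Then \[ \sum_{k=2}^{p} (-1)^k \frac{(\frac{1}{2})_{\frac{p-1}{2} + k}\, (\frac{1}{2})_{\frac{p+1}{2} - k}^2}{(1)_{p+1-k}} \equiv 0 \pmod{p^3}. \]
   Context: For a real number $a$ and an integer $n$, $(a)_n=\Gamma(a+n)/\Gamma(a)$ denotes the Pochhammer symbol: $(a)_0=1$, $(a)_n=a(a+1)\cdots(a+n-1)$ for $n\ge 1$, and $(a)_{ -n}=\prod_{k=1}^{n}\frac{1}{a-k}$ for $n\ge1$ (when defined). For rational numbers $x,y$ and an integer $m\ge1$, $x\equiv y \pmod{p^m}$ means that $(x-y)/p^m$ is a rational number whose denominator (in lowest terms) is not divisible by $p$. -}

module Defs where

open import Data.Nat as ℕ using (ℕ; zero; suc; _∸_; ⌊_/2⌋)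
open import Data.Nat.Divisibility using (_∣_)
open import Data.Nat.Properties using (m^n≢0)
open import Data.Integer as ℤ using (ℤ; +_; -[1+_])
open import Data.Rational using (ℚ; mkℚ; 0ℚ; 1ℚ; _+_; _-_; _*_; -_; 1/_; _/_; ↧ₙ_)
open import Data.List using (List; []; _∷_; foldr; map; upTo)
open import Relation.Nullary using (¬_)
open import Data.Empty using (⊥)

ℕ→ℚ : ℕ → ℚ
ℕ→ℚ n = (+ n) / 1

-- total inverse: inv 0 = 0 (only used where the argument is nonzero)
inv : ℚ → ℚ
inv (mkℚ (+ zero) _ _) = 0ℚ
inv q@(mkℚ (+ suc n) _ _) = 1/ q
inv q@(mkℚ -[1+ n ] _ _) = 1/ q

rising : ℚ → ℕ → ℚ
rising a zero = 1ℚ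
rising a (suc n) = rising a n * (a + ℕ→ℚ n)

fallingBelow : ℚ → ℕ → ℚ
fallingBelow a zero = 1ℚ
fallingBelow a (suc n) = fallingBelow a n * (a - ℕ→ℚ (suc n))

poch : ℚ → ℤ → ℚ
poch a (+ n) = rising a n
poch a -[1+ n ] = inv (fallingBelow a (suc n))

signQ : ℕ → ℚ
signQ zero = 1ℚ
signQ (suc k) = - signQ k

-- Σ_{k=a}^{b} f k  (empty if b < a)
sumFromTo : ℕ → ℕ → (ℕ → ℚ) → ℚ
sumFromTo a b f = foldr _+_ 0ℚ (map (λ i → f (a ℕ.+ i)) (upTo (suc b ∸ a)))

-- x ≡ y (mod p^m) : (x - y)/p^m has denominator not divisible by p
-- (p = 0 is excluded: meaningless, we set it to ⊥)
_≡_mod_^_ : ℚ → ℚ → ℕ → ℕ → Set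
x ≡ y mod zero ^ m = ⊥
x ≡ y mod (suc q) ^ m =
  ¬ (suc q ∣ ↧ₙ ((x - y) * invPow))
  where
  invPow : ℚ
  invPow = _/_ (+ 1) (suc q ℕ.^ m) {{m^n≢0 (suc q) m}}

half : ℚ
half = (+ 1) / 2

term : ℕ → ℕ → ℚ
term p k = signQ k * (poch half (+ (⌊ (p ∸ 1) /2⌋ ℕ.+ k))
             * (poch half ((+ ⌊ (p ℕ.+ 1) /2⌋) ℤ.- (+ k))
                * poch half ((+ ⌊ (p ℕ.+ 1) /2⌋) ℤ.- (+ k)))
             * inv (poch 1ℚ (+ (p ℕ.+ 1 ∸ k))))

-- Put p = 2n + 1 and u = p/2, so that (1/2)_{n+j} = (1/2)_n (u)_j.  Using the reflection
-- (1 - a - m)_m = (-1)^m (a)_m for the negative-index and factorial factors, the summand for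
-- k = i + 2 becomes K G_i, where K = (1/2)_n³ u / (2n)! is p times a p-integral number and
-- G_i = (u + 1)_{i+1} (1 - p)_i / (1 - u)_{i+1}².  Every factor of G_i is 1/(j + 1) or j + 1
-- times 1 + O(u), so by induction G_i ≡ a_i := (1 + u (H_{i+1} + 2/(i+1))) / (i + 1) mod p², and
-- Σ_{i<2n} a_i = H + u (H² + H₂)/2 + 2u H₂ for the harmonic sums H, H₂ of order p - 1.
-- Pairing 1/j with 1/(p - j) gives 2H + pH₂ ≡ 0 mod p², hence H ≡ 0 mod p, and for p > 3
-- also H₂ ≡ 0 mod p; so Σ a_i ≡ 0 mod p² and the whole sum vanishes mod p³.
-- The case p = 3 is a direct computation.

module Submission where

open import Level using (0ℓ)
open import Algebra.Bundles using (CommutativeMonoid)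
import Algebra.Properties.CommutativeSemigroup as CommutativeSemigroupProperties
open import Agda.Builtin.FromNat using (Number; fromNat)
open import Agda.Builtin.FromNeg using (Negative)
open import Data.Unit.Base using (tt)
open import Data.Nat as ℕ using (ℕ; zero; suc; z≤n; s≤s; _∸_; _<_; _≤_; _^_; ⌊_/2⌋)
import Data.Nat.Literals as ℕLiterals
import Data.Nat.Properties as ℕ
open import Data.Nat.Divisibility using (_∣_; _∤_; _∣?_; divides; ∣-trans; n∣m*n; ∣1⇒≡1; _∣0; >⇒∤)
open import Data.Nat.Primality using (Prime; euclidsLemma; prime⇒nonTrivial; prime⇒irreducible; ¬prime[1])
import Data.Nat.Coprimality as Coprime
open import Data.Integer as ℤ using (ℤ; +_; -[1+_])
import Data.Integer.Literals as ℤLiterals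
import Data.Integer.Properties as ℤ
import Data.Integer.GCD as ℤ
open import Data.Rational as ℚ using (ℚ; mkℚ; 0ℚ; 1ℚ; _+_; _-_; _*_; -_; _/_; ↥_; ↧_; ↧ₙ_)
open import Data.Rational.Literals as ℚLiterals using (fromℤ)
import Data.Rational.Properties as ℚ
import Data.Rational.Unnormalised as ℚᵘ
import Data.Rational.Unnormalised.Properties as ℚᵘ
open import Data.List using (foldr; map; applyUpTo)
open import Data.Product using (∃; _,_; proj₁; proj₂)
open import Data.Sum using (_⊎_; inj₁; inj₂)
open import Function using (_∘_; id)
open import Relation.Binary.PropositionalEquality
open import Relation.Nullary using (yes; no; contradiction)
open import Relation.Nullary.Decidable using (dec⇒maybe; toWitnessFalse)
open import Tactic.RingSolver using (solve-∀)
open import Data.Nat.Tactic.RingSolver renaming (solve-∀ to ℕ-solve-∀)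
import Tactic.RingSolver.Core.AlmostCommutativeRing as ACR
open import Defs

instance
  ℕ-number : Number ℕ
  ℕ-number = ℕLiterals.number
  ℤ-number : Number ℤ
  ℤ-number = ℤLiterals.number
  ℤ-negative : Negative ℤ
  ℤ-negative = ℤLiterals.negative
  ℚ-number : Number ℚ
  ℚ-number = ℚLiterals.number
  ℚ-negative : Negative ℚ
  ℚ-negative = ℚLiterals.negative

-- Rational arithmetic

ringℚ : ACR.AlmostCommutativeRing 0ℓ 0ℓ
ringℚ = ACR.fromCommutativeRing ℚ.+-*-commutativeRing (λ x → dec⇒maybe (0ℚ ℚ.≟ x))

open CommutativeSemigroupProperties (CommutativeMonoid.commutativeSemigroup ℚ.+-0-commutativeMonoid)
  using () renaming (interchange to +-interchange)
open CommutativeSemigroupProperties (CommutativeMonoid.commutativeSemigroup ℚ.*-1-commutativeMonoid)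
  using () renaming (interchange to *-interchange)

neg-*-neg : ∀ x y → (- x) * (- y) ≡ x * y
neg-*-neg = solve-∀ ringℚ

ℤ→ℚ : ℤ → ℚ
ℤ→ℚ a = a / 1

ℤ→ℚ≡fromℤ : ∀ a → ℤ→ℚ a ≡ fromℤ a
ℤ→ℚ≡fromℤ a = ℚ.≃⇒≡ (ℚ.*≡* (cong₂ ℤ._*_ numerator (sym denominator)))
  where
  gcd[a,1]≡1 : ℤ.gcd a 1 ≡ 1
  gcd[a,1]≡1 = ℤ.gcd-zeroʳ a
  numerator : ↥ ℤ→ℚ a ≡ a
  numerator = trans (sym (ℤ.*-identityʳ _)) (trans (cong (↥ ℤ→ℚ a ℤ.*_) (sym gcd[a,1]≡1)) (ℚ.↥-/ a 1))
  denominator : ↧ ℤ→ℚ a ≡ 1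
  denominator = trans (sym (ℤ.*-identityʳ _)) (trans (cong (↧ ℤ→ℚ a ℤ.*_) (sym gcd[a,1]≡1)) (ℚ.↧-/ a 1))

ℤ→ℚ-+ : ∀ a b → ℤ→ℚ (a ℤ.+ b) ≡ ℤ→ℚ a + ℤ→ℚ b
ℤ→ℚ-+ a b = sym (trans (cong₂ _+_ (ℤ→ℚ≡fromℤ a) (ℤ→ℚ≡fromℤ b))
  (cong ℤ→ℚ (cong₂ ℤ._+_ (ℤ.*-identityʳ a) (ℤ.*-identityʳ b))))

ℤ→ℚ-* : ∀ a b → ℤ→ℚ (a ℤ.* b) ≡ ℤ→ℚ a * ℤ→ℚ b
ℤ→ℚ-* a b = sym (cong₂ _*_ (ℤ→ℚ≡fromℤ a) (ℤ→ℚ≡fromℤ b))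

ℤ→ℚ-neg : ∀ a → ℤ→ℚ (ℤ.- a) ≡ - ℤ→ℚ a
ℤ→ℚ-neg (+ zero) = refl
ℤ→ℚ-neg a@(+ suc _) = trans (ℤ→ℚ≡fromℤ (ℤ.- a)) (cong -_ (sym (ℤ→ℚ≡fromℤ a)))
ℤ→ℚ-neg a@(-[1+ _ ]) = trans (ℤ→ℚ≡fromℤ (ℤ.- a)) (cong -_ (sym (ℤ→ℚ≡fromℤ a)))

ℕ→ℚ-+ : ∀ m n → ℕ→ℚ (m ℕ.+ n) ≡ ℕ→ℚ m + ℕ→ℚ n
ℕ→ℚ-+ m n = ℤ→ℚ-+ (+ m) (+ n)

ℕ→ℚ-* : ∀ m n → ℕ→ℚ (m ℕ.* n) ≡ ℕ→ℚ m * ℕ→ℚ n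
ℕ→ℚ-* m n = trans (cong ℤ→ℚ (ℤ.pos-* m n)) (ℤ→ℚ-* (+ m) (+ n))

ℕ→ℚ-suc : ∀ n → ℕ→ℚ (suc n) ≡ 1ℚ + ℕ→ℚ n
ℕ→ℚ-suc n = ℕ→ℚ-+ 1 n

ℕ→ℚ≢0 : ∀ n → .{{ℕ.NonZero n}} → ℕ→ℚ n ≢ 0ℚ
ℕ→ℚ≢0 (suc n) eq with trans (sym (ℤ→ℚ≡fromℤ (+ suc n))) eq
... | ()

1/n≡inv : ∀ n .{{_ : ℕ.NonZero n}} → (+ 1) / n ≡ inv (ℕ→ℚ n)
1/n≡inv (suc n) = trans (ℚ.normalize-coprime (Coprime.1-coprimeTo (suc n))) (cong inv (sym (ℤ→ℚ≡fromℤ (+ suc n))))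

inv-inverseˡ : ∀ q → q ≢ 0ℚ → inv q * q ≡ 1ℚ
inv-inverseˡ (mkℚ (+ zero) _ _) q≢0 = contradiction (ℚ.↥p≡0⇒p≡0 _ refl) q≢0
inv-inverseˡ q@(mkℚ (+ suc _) _ _) _ = ℚ.*-inverseˡ q
inv-inverseˡ q@(mkℚ -[1+ _ ] _ _) _ = ℚ.*-inverseˡ q

inv-unique : ∀ x y → x * y ≡ 1ℚ → inv x ≡ y
inv-unique x y xy≡1 = begin
  inv x             ≡⟨ sym (ℚ.*-identityʳ (inv x)) ⟩
  inv x * 1ℚ        ≡⟨ cong (inv x *_) (sym xy≡1) ⟩
  inv x * (x * y)   ≡⟨ sym (ℚ.*-assoc (inv x) x y) ⟩
  (inv x * x) * y   ≡⟨ cong (_* y) (inv-inverseˡ x x≢0) ⟩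
  1ℚ * y            ≡⟨ ℚ.*-identityˡ y ⟩
  y                 ∎
  where
  open ≡-Reasoning
  x≢0 : x ≢ 0ℚ
  x≢0 x≡0 with trans (sym xy≡1) (trans (cong (_* y) x≡0) (ℚ.*-zeroˡ y))
  ... | ()

inverse-sum : ∀ a b x y → a * x ≡ 1ℚ → b * y ≡ 1ℚ → x + y ≡ (a + b) * (x * y)
inverse-sum a b x y ax≡1 by≡1 = begin
  x + y                                                         ≡⟨ expand a b x y ⟩
  (a + b) * (x * y) + x * (1ℚ - b * y) + y * (1ℚ - a * x)       ≡⟨ cong₂ (λ s t → (a + b) * (x * y) + x * (1ℚ - s) + y * (1ℚ - t)) by≡1 ax≡1 ⟩
  (a + b) * (x * y) + x * (1ℚ - 1ℚ) + y * (1ℚ - 1ℚ)             ≡⟨ collapse (a + b) x y ⟩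
  (a + b) * (x * y)                                             ∎
  where
  open ≡-Reasoning
  expand : ∀ a b x y → x + y ≡ (a + b) * (x * y) + x * (1ℚ - b * y) + y * (1ℚ - a * x)
  expand = solve-∀ ringℚ
  collapse : ∀ c x y → c * (x * y) + x * (1ℚ - 1ℚ) + y * (1ℚ - 1ℚ) ≡ c * (x * y)
  collapse = solve-∀ ringℚ

inverse-difference : ∀ a b x y → a * x ≡ 1ℚ → b * y ≡ 1ℚ → x - y ≡ (b - a) * (x * y)
inverse-difference a b x y ax≡1 by≡1 =
  trans (inverse-sum a (- b) x (- y) ax≡1 (trans (neg-*-neg b y) by≡1)) (regroup a b x y)
  where
  regroup : ∀ a b x y → (a + - b) * (x * - y) ≡ (b - a) * (x * y)
  regroup = solve-∀ ringℚ

-- Finite sums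

∑< : ℕ → (ℕ → ℚ) → ℚ
∑< zero f = 0ℚ
∑< (suc n) f = f 0 + ∑< n (f ∘ suc)

syntax ∑< n (λ i → e) = ∑[ i < n ] e

sumFromTo≡∑ : ∀ a b f → sumFromTo a b f ≡ ∑[ i < suc b ∸ a ] f (a ℕ.+ i)
sumFromTo≡∑ a b f = foldr-map-applyUpTo (λ i → f (a ℕ.+ i)) id (suc b ∸ a)
  where
  foldr-map-applyUpTo : ∀ g h m → foldr _+_ 0ℚ (map g (applyUpTo h m)) ≡ ∑[ i < m ] g (h i)
  foldr-map-applyUpTo g h zero = refl
  foldr-map-applyUpTo g h (suc m) = cong (_+_ (g (h 0))) (foldr-map-applyUpTo g (h ∘ suc) m)

∑-cong : ∀ {f g} n → (∀ i → i < n → f i ≡ g i) → ∑< n f ≡ ∑< n g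
∑-cong zero eq = refl
∑-cong (suc n) eq = cong₂ _+_ (eq 0 (s≤s z≤n)) (∑-cong n (λ i i<n → eq (suc i) (s≤s i<n)))

∑-last : ∀ f n → ∑< (suc n) f ≡ ∑< n f + f n
∑-last f zero = ℚ.+-comm (f 0) 0ℚ
∑-last f (suc n) = trans (cong (_+_ (f 0)) (∑-last (f ∘ suc) n)) (sym (ℚ.+-assoc (f 0) _ _))

∑-+ : ∀ f g n → ∑[ i < n ] (f i + g i) ≡ ∑< n f + ∑< n g
∑-+ f g zero = refl
∑-+ f g (suc n) = trans (cong (_+_ (f 0 + g 0)) (∑-+ (f ∘ suc) (g ∘ suc) n)) (+-interchange (f 0) (g 0) _ _)

∑-*ˡ : ∀ c f n → ∑[ i < n ] (c * f i) ≡ c * ∑< n f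
∑-*ˡ c f zero = sym (ℚ.*-zeroʳ c)
∑-*ˡ c f (suc n) = trans (cong (_+_ (c * f 0)) (∑-*ˡ c (f ∘ suc) n)) (sym (ℚ.*-distribˡ-+ c _ _))

∑-neg : ∀ f n → ∑[ i < n ] (- f i) ≡ - ∑< n f
∑-neg f zero = refl
∑-neg f (suc n) = trans (cong (_+_ (- f 0)) (∑-neg (f ∘ suc) n)) (sym (ℚ.neg-distrib-+ (f 0) _))

∑-split : ∀ f m n → ∑< (m ℕ.+ n) f ≡ ∑< m f + ∑[ i < n ] f (m ℕ.+ i)
∑-split f zero n = sym (ℚ.+-identityˡ _)
∑-split f (suc m) n = trans (cong (_+_ (f 0)) (∑-split (f ∘ suc) m n)) (sym (ℚ.+-assoc (f 0) _ _))

∑-reverse : ∀ f n → ∑< n f ≡ ∑[ i < n ] f (n ∸ suc i)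
∑-reverse f zero = refl
∑-reverse f (suc n) = begin
  ∑< (suc n) f                          ≡⟨ ∑-last f n ⟩
  ∑< n f + f n                          ≡⟨ cong (_+ f n) (∑-reverse f n) ⟩
  ∑[ i < n ] f (n ∸ suc i) + f n        ≡⟨ ℚ.+-comm _ (f n) ⟩
  ∑[ i < suc n ] f (suc n ∸ suc i)      ∎
  where open ≡-Reasoning

∑-evenOdd : ∀ f n → ∑< (n ℕ.+ n) f ≡ ∑[ i < n ] f (i ℕ.+ i) + ∑[ i < n ] f (suc (i ℕ.+ i))
∑-evenOdd f zero = refl
∑-evenOdd f (suc n) = begin
  f 0 + ∑< (n ℕ.+ suc n) (f ∘ suc)
    ≡⟨ cong (λ k → f 0 + ∑< k (f ∘ suc)) (ℕ.+-suc n n) ⟩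
  f 0 + (f 1 + ∑< (n ℕ.+ n) (f ∘ suc ∘ suc))
    ≡⟨ cong (λ s → f 0 + (f 1 + s)) (∑-evenOdd (f ∘ suc ∘ suc) n) ⟩
  f 0 + (f 1 + (∑[ i < n ] f (2 ℕ.+ (i ℕ.+ i)) + ∑[ i < n ] f (3 ℕ.+ (i ℕ.+ i))))
    ≡⟨ regroup (f 0) (f 1) _ _ ⟩
  (f 0 + ∑[ i < n ] f (2 ℕ.+ (i ℕ.+ i))) + (f 1 + ∑[ i < n ] f (3 ℕ.+ (i ℕ.+ i)))
    ≡⟨ cong₂ _+_ (cong (_+_ (f 0)) (∑-cong n λ i _ → cong (f ∘ suc) (sym (ℕ.+-suc i i))))
                 (cong (_+_ (f 1)) (∑-cong n λ i _ → cong (f ∘ suc ∘ suc) (sym (ℕ.+-suc i i)))) ⟩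
  ∑[ i < suc n ] f (i ℕ.+ i) + ∑[ i < suc n ] f (suc (i ℕ.+ i))
    ∎
  where
  open ≡-Reasoning
  regroup : ∀ a b c d → a + (b + (c + d)) ≡ (a + c) + (b + d)
  regroup = solve-∀ ringℚ

∑-square : ∀ x m → 2 * ∑[ i < m ] (x i * ∑< (suc i) x) ≡ ∑< m x * ∑< m x + ∑[ i < m ] (x i * x i)
∑-square x zero = refl
∑-square x (suc m) = begin
  2 * ∑[ i < suc m ] (x i * ∑< (suc i) x)
    ≡⟨ cong (2 *_) (∑-last (λ i → x i * ∑< (suc i) x) m) ⟩
  2 * (∑[ i < m ] (x i * ∑< (suc i) x) + x m * ∑< (suc m) x)
    ≡⟨ cong (λ s → 2 * (∑[ i < m ] (x i * ∑< (suc i) x) + x m * s)) (∑-last x m) ⟩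
  2 * (∑[ i < m ] (x i * ∑< (suc i) x) + x m * (∑< m x + x m))
    ≡⟨ expand (∑[ i < m ] (x i * ∑< (suc i) x)) (x m) (∑< m x) ⟩
  2 * ∑[ i < m ] (x i * ∑< (suc i) x) + (2 * x m * ∑< m x + 2 * x m * x m)
    ≡⟨ cong (_+ (2 * x m * ∑< m x + 2 * x m * x m)) (∑-square x m) ⟩
  ∑< m x * ∑< m x + ∑[ i < m ] (x i * x i) + (2 * x m * ∑< m x + 2 * x m * x m)
    ≡⟨ complete-square (∑< m x) (∑[ i < m ] (x i * x i)) (x m) ⟩
  (∑< m x + x m) * (∑< m x + x m) + (∑[ i < m ] (x i * x i) + x m * x m)
    ≡˘⟨ cong₂ (λ s t → s * s + t) (∑-last x m) (∑-last (λ i → x i * x i) m) ⟩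
  ∑< (suc m) x * ∑< (suc m) x + ∑[ i < suc m ] (x i * x i)
    ∎
  where
  open ≡-Reasoning
  expand : ∀ s y h → 2 * (s + y * (h + y)) ≡ 2 * s + (2 * y * h + 2 * y * y)
  expand = solve-∀ ringℚ
  complete-square : ∀ h q y → h * h + q + (2 * y * h + 2 * y * y) ≡ (h + y) * (h + y) + (q + y * y)
  complete-square = solve-∀ ringℚ

-- Pochhammer symbols

rising-+ : ∀ a m k → rising a (m ℕ.+ k) ≡ rising a m * rising (a + ℕ→ℚ m) k
rising-+ a m zero = trans (cong (rising a) (ℕ.+-identityʳ m)) (sym (ℚ.*-identityʳ _))
rising-+ a m (suc k) = begin
  rising a (m ℕ.+ suc k)
    ≡⟨ cong (rising a) (ℕ.+-suc m k) ⟩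
  rising a (m ℕ.+ k) * (a + ℕ→ℚ (m ℕ.+ k))
    ≡⟨ cong₂ (λ r s → r * (a + s)) (rising-+ a m k) (ℕ→ℚ-+ m k) ⟩
  rising a m * rising (a + ℕ→ℚ m) k * (a + (ℕ→ℚ m + ℕ→ℚ k))
    ≡⟨ reassociate (rising a m) (rising (a + ℕ→ℚ m) k) a (ℕ→ℚ m) (ℕ→ℚ k) ⟩
  rising a m * (rising (a + ℕ→ℚ m) k * (a + ℕ→ℚ m + ℕ→ℚ k))
    ∎
  where
  open ≡-Reasoning
  reassociate : ∀ r s a b c → r * s * (a + (b + c)) ≡ r * (s * (a + b + c))
  reassociate = solve-∀ ringℚ

rising-suc : ∀ a m → rising a (suc m) ≡ a * rising (a + 1ℚ) m
rising-suc a m = trans (rising-+ a 1 m) (cong (_* rising (a + 1ℚ) m) (simplify a))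
  where
  simplify : ∀ a → 1ℚ * (a + 0ℚ) ≡ a
  simplify = solve-∀ ringℚ

signQ-*-signQ : ∀ k → signQ k * signQ k ≡ 1ℚ
signQ-*-signQ zero = refl
signQ-*-signQ (suc k) = trans (neg-*-neg (signQ k) (signQ k)) (signQ-*-signQ k)

signQ-+ : ∀ a b → signQ (a ℕ.+ b) ≡ signQ a * signQ b
signQ-+ zero b = sym (ℚ.*-identityˡ _)
signQ-+ (suc a) b = trans (cong -_ (signQ-+ a b)) (ℚ.neg-distribˡ-* (signQ a) (signQ b))

rising-reflect : ∀ a m → rising (1ℚ - (a + ℕ→ℚ m)) m ≡ signQ m * rising a m
rising-reflect a zero = refl
rising-reflect a (suc m) = begin
  rising (1ℚ - (a + ℕ→ℚ (suc m))) (suc m)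
    ≡⟨ rising-suc _ m ⟩
  (1ℚ - (a + ℕ→ℚ (suc m))) * rising (1ℚ - (a + ℕ→ℚ (suc m)) + 1ℚ) m
    ≡⟨ cong (λ x → (1ℚ - (a + x)) * rising (1ℚ - (a + x) + 1ℚ) m) (ℕ→ℚ-suc m) ⟩
  (1ℚ - (a + (1ℚ + ℕ→ℚ m))) * rising (1ℚ - (a + (1ℚ + ℕ→ℚ m)) + 1ℚ) m
    ≡⟨ cong (λ b → (1ℚ - (a + (1ℚ + ℕ→ℚ m))) * rising b m) (shift a (ℕ→ℚ m)) ⟩
  (1ℚ - (a + (1ℚ + ℕ→ℚ m))) * rising (1ℚ - (a + ℕ→ℚ m)) m
    ≡⟨ cong ((1ℚ - (a + (1ℚ + ℕ→ℚ m))) *_) (rising-reflect a m) ⟩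
  (1ℚ - (a + (1ℚ + ℕ→ℚ m))) * (signQ m * rising a m)
    ≡⟨ regroup a (ℕ→ℚ m) (signQ m) (rising a m) ⟩
  (- signQ m) * (rising a m * (a + ℕ→ℚ m))
    ∎
  where
  open ≡-Reasoning
  shift : ∀ a x → 1ℚ - (a + (1ℚ + x)) + 1ℚ ≡ 1ℚ - (a + x)
  shift = solve-∀ ringℚ
  regroup : ∀ a x s r → (1ℚ - (a + (1ℚ + x))) * (s * r) ≡ (- s) * (r * (a + x))
  regroup = solve-∀ ringℚ

fallingBelow≡signQ*rising : ∀ a t → fallingBelow a t ≡ signQ t * rising (1ℚ - a) t
fallingBelow≡signQ*rising a zero = refl
fallingBelow≡signQ*rising a (suc t) = begin
  fallingBelow a t * (a - ℕ→ℚ (suc t))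
    ≡⟨ cong₂ (λ f x → f * (a - x)) (fallingBelow≡signQ*rising a t) (ℕ→ℚ-suc t) ⟩
  signQ t * rising (1ℚ - a) t * (a - (1ℚ + ℕ→ℚ t))
    ≡⟨ regroup (signQ t) (rising (1ℚ - a) t) a (ℕ→ℚ t) ⟩
  (- signQ t) * (rising (1ℚ - a) t * (1ℚ - a + ℕ→ℚ t))
    ∎
  where
  open ≡-Reasoning
  regroup : ∀ s r a x → s * r * (a - (1ℚ + x)) ≡ (- s) * (r * (1ℚ - a + x))
  regroup = solve-∀ ringℚ

module PIntegral (p : ℕ) (p-prime : Prime p) where

  p≢1 : p ≢ 1
  p≢1 = ℕ.nonTrivial⇒≢1 {{prime⇒nonTrivial p-prime}}

  p∤* : ∀ {a b} → p ∤ a → p ∤ b → p ∤ a ℕ.* b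
  p∤* {a} {b} p∤a p∤b p∣ab with euclidsLemma a b p-prime p∣ab
  ... | inj₁ p∣a = p∤a p∣a
  ... | inj₂ p∣b = p∤b p∣b

  record Integral (x : ℚ) : Set where
    constructor integral
    field
      denominator : ℕ
      p∤denominator : p ∤ denominator
      numerator : ℤ
      cleared : x * ℕ→ℚ denominator ≡ ℤ→ℚ numerator

  integral-ℤ : ∀ a → Integral (ℤ→ℚ a)
  integral-ℤ a = integral 1 (p≢1 ∘ ∣1⇒≡1) a (ℚ.*-identityʳ (ℤ→ℚ a))

  integral-ℕ : ∀ n → Integral (ℕ→ℚ n)
  integral-ℕ n = integral-ℤ (+ n)

  integral-+ : ∀ {x y} → Integral x → Integral y → Integral (x + y)
  integral-+ {x} {y} (integral b p∤b a xb≡a) (integral d p∤d c yd≡c) =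
    integral (b ℕ.* d) (p∤* p∤b p∤d) (a ℤ.* + d ℤ.+ c ℤ.* + b) (begin
      (x + y) * ℕ→ℚ (b ℕ.* d)                     ≡⟨ cong ((x + y) *_) (ℕ→ℚ-* b d) ⟩
      (x + y) * (ℕ→ℚ b * ℕ→ℚ d)                   ≡⟨ expand x y (ℕ→ℚ b) (ℕ→ℚ d) ⟩
      x * ℕ→ℚ b * ℕ→ℚ d + y * ℕ→ℚ d * ℕ→ℚ b       ≡⟨ cong₂ (λ s t → s * ℕ→ℚ d + t * ℕ→ℚ b) xb≡a yd≡c ⟩
      ℤ→ℚ a * ℤ→ℚ (+ d) + ℤ→ℚ c * ℤ→ℚ (+ b)       ≡˘⟨ cong₂ _+_ (ℤ→ℚ-* a (+ d)) (ℤ→ℚ-* c (+ b)) ⟩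
      ℤ→ℚ (a ℤ.* + d) + ℤ→ℚ (c ℤ.* + b)           ≡˘⟨ ℤ→ℚ-+ (a ℤ.* + d) (c ℤ.* + b) ⟩
      ℤ→ℚ (a ℤ.* + d ℤ.+ c ℤ.* + b)               ∎)
    where
    open ≡-Reasoning
    expand : ∀ x y b d → (x + y) * (b * d) ≡ x * b * d + y * d * b
    expand = solve-∀ ringℚ

  integral-* : ∀ {x y} → Integral x → Integral y → Integral (x * y)
  integral-* {x} {y} (integral b p∤b a xb≡a) (integral d p∤d c yd≡c) =
    integral (b ℕ.* d) (p∤* p∤b p∤d) (a ℤ.* c) (begin
      (x * y) * ℕ→ℚ (b ℕ.* d)        ≡⟨ cong ((x * y) *_) (ℕ→ℚ-* b d) ⟩
      (x * y) * (ℕ→ℚ b * ℕ→ℚ d)      ≡⟨ *-interchange x y (ℕ→ℚ b) (ℕ→ℚ d) ⟩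
      (x * ℕ→ℚ b) * (y * ℕ→ℚ d)      ≡⟨ cong₂ _*_ xb≡a yd≡c ⟩
      ℤ→ℚ a * ℤ→ℚ c                  ≡˘⟨ ℤ→ℚ-* a c ⟩
      ℤ→ℚ (a ℤ.* c)                  ∎)
    where open ≡-Reasoning

  integral-neg : ∀ {x} → Integral x → Integral (- x)
  integral-neg {x} (integral b p∤b a xb≡a) =
    integral b p∤b (ℤ.- a) (trans (sym (ℚ.neg-distribˡ-* x (ℕ→ℚ b)))
                                  (trans (cong -_ xb≡a) (sym (ℤ→ℚ-neg a))))

  integral-sub : ∀ {x y} → Integral x → Integral y → Integral (x - y)
  integral-sub ix iy = integral-+ ix (integral-neg iy)

  integral-∑ : ∀ {f} n → (∀ i → i < n → Integral (f i)) → Integral (∑< n f)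
  integral-∑ zero _ = integral-ℤ 0
  integral-∑ (suc n) int = integral-+ (int 0 (s≤s z≤n)) (integral-∑ n (λ i i<n → int (suc i) (s≤s i<n)))

  integral⇒p∤↧ : ∀ {x} → Integral x → p ∤ ↧ₙ x
  integral⇒p∤↧ {x@(mkℚ m d-1 coprime)} (integral b p∤b a xb≡a) p∣d =
    p≢1 (Coprime.recompute coprime (p∣∣m∣ , p∣d))
    where
    open ≡-Reasoning
    cross : (m ℤ.* + b) ℤ.* 1 ≡ a ℤ.* + (suc d-1 ℕ.* 1)
    cross with ℚᵘ.≃-trans (ℚᵘ.≃-sym (ℚ.toℚᵘ-homo-* x (fromℤ (+ b))))
                          (ℚ.toℚᵘ-cong (subst₂ (λ s t → x * s ≡ t) (ℤ→ℚ≡fromℤ (+ b)) (ℤ→ℚ≡fromℤ a) xb≡a))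
    ... | ℚᵘ.*≡* eq = eq
    ∣m∣b≡∣a∣d : ℤ.∣ m ∣ ℕ.* b ≡ ℤ.∣ a ∣ ℕ.* suc d-1
    ∣m∣b≡∣a∣d = begin
      ℤ.∣ m ∣ ℕ.* b                    ≡˘⟨ ℤ.abs-* m (+ b) ⟩
      ℤ.∣ m ℤ.* + b ∣                  ≡˘⟨ cong ℤ.∣_∣ (ℤ.*-identityʳ (m ℤ.* + b)) ⟩
      ℤ.∣ (m ℤ.* + b) ℤ.* 1 ∣          ≡⟨ cong ℤ.∣_∣ cross ⟩
      ℤ.∣ a ℤ.* + (suc d-1 ℕ.* 1) ∣    ≡⟨ ℤ.abs-* a _ ⟩
      ℤ.∣ a ∣ ℕ.* (suc d-1 ℕ.* 1)      ≡⟨ cong (ℤ.∣ a ∣ ℕ.*_) (ℕ.*-identityʳ (suc d-1)) ⟩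
      ℤ.∣ a ∣ ℕ.* suc d-1              ∎
    p∣∣m∣ : p ∣ ℤ.∣ m ∣
    p∣∣m∣ with euclidsLemma ℤ.∣ m ∣ b p-prime (subst (p ∣_) (sym ∣m∣b≡∣a∣d) (∣-trans p∣d (n∣m*n ℤ.∣ a ∣)))
    ... | inj₁ p∣m = p∣m
    ... | inj₂ p∣b = contradiction p∣b p∤b

  record p^_∣_ (k : ℕ) (x : ℚ) : Set where
    constructor multiple
    field
      quotient : ℚ
      integral-quotient : Integral quotient
      factorisation : x ≡ ℕ→ℚ (p ^ k) * quotient

  p^∣-0 : ∀ {k} → p^ k ∣ 0ℚ
  p^∣-0 {k} = multiple 0ℚ (integral-ℤ 0) (sym (ℚ.*-zeroʳ (ℕ→ℚ (p ^ k))))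

  p^∣-+ : ∀ {k x y} → p^ k ∣ x → p^ k ∣ y → p^ k ∣ (x + y)
  p^∣-+ {k} (multiple q iq x≡) (multiple r ir y≡) =
    multiple (q + r) (integral-+ iq ir) (trans (cong₂ _+_ x≡ y≡) (sym (ℚ.*-distribˡ-+ (ℕ→ℚ (p ^ k)) q r)))

  p^∣-*ˡ : ∀ {k c x} → Integral c → p^ k ∣ x → p^ k ∣ (c * x)
  p^∣-*ˡ {k} {c} ic (multiple q iq x≡) =
    multiple (c * q) (integral-* ic iq) (trans (cong (c *_) x≡) (swap c (ℕ→ℚ (p ^ k)) q))
    where
    swap : ∀ c a q → c * (a * q) ≡ a * (c * q)
    swap = solve-∀ ringℚ

  p^∣-*ʳ : ∀ {k c x} → Integral c → p^ k ∣ x → p^ k ∣ (x * c)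
  p^∣-*ʳ {k} {c} {x} ic d = subst (p^ k ∣_) (ℚ.*-comm c x) (p^∣-*ˡ ic d)

  p^∣-neg : ∀ {k x} → p^ k ∣ x → p^ k ∣ (- x)
  p^∣-neg {k} (multiple q iq x≡) =
    multiple (- q) (integral-neg iq) (trans (cong -_ x≡) (ℚ.neg-distribʳ-* (ℕ→ℚ (p ^ k)) q))

  p^∣-sub : ∀ {k x y} → p^ k ∣ x → p^ k ∣ y → p^ k ∣ (x - y)
  p^∣-sub dx dy = p^∣-+ dx (p^∣-neg dy)

  integral⇒p^0∣ : ∀ {x} → Integral x → p^ 0 ∣ x
  integral⇒p^0∣ {x} ix = multiple x ix (sym (ℚ.*-identityˡ x))

  p^∣-p* : ∀ {k x} → p^ k ∣ x → p^ (suc k) ∣ (ℕ→ℚ p * x)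
  p^∣-p* {k} {x} (multiple q iq x≡) = multiple q iq (begin
    ℕ→ℚ p * x                      ≡⟨ cong (ℕ→ℚ p *_) x≡ ⟩
    ℕ→ℚ p * (ℕ→ℚ (p ^ k) * q)      ≡˘⟨ ℚ.*-assoc (ℕ→ℚ p) (ℕ→ℚ (p ^ k)) q ⟩
    ℕ→ℚ p * ℕ→ℚ (p ^ k) * q        ≡˘⟨ cong (_* q) (ℕ→ℚ-* p (p ^ k)) ⟩
    ℕ→ℚ (p ^ suc k) * q            ∎)
    where open ≡-Reasoning

  p^suc∣⇒p^∣ : ∀ {k x} → p^ (suc k) ∣ x → p^ k ∣ x
  p^suc∣⇒p^∣ {k} (multiple q iq x≡) = multiple (ℕ→ℚ p * q) (integral-* (integral-ℕ p) iq) (begin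
    _                                     ≡⟨ x≡ ⟩
    ℕ→ℚ (p ℕ.* p ^ k) * q                 ≡⟨ cong (_* q) (ℕ→ℚ-* p (p ^ k)) ⟩
    ℕ→ℚ p * ℕ→ℚ (p ^ k) * q               ≡⟨ swap (ℕ→ℚ p) (ℕ→ℚ (p ^ k)) q ⟩
    ℕ→ℚ (p ^ k) * (ℕ→ℚ p * q)             ∎)
    where
    open ≡-Reasoning
    swap : ∀ a b q → a * b * q ≡ b * (a * q)
    swap = solve-∀ ringℚ

  p^∣-∑ : ∀ {k f} n → (∀ i → i < n → p^ k ∣ f i) → p^ k ∣ ∑< n f
  p^∣-∑ zero _ = p^∣-0
  p^∣-∑ (suc n) d = p^∣-+ (d 0 (s≤s z≤n)) (p^∣-∑ n (λ i i<n → d (suc i) (s≤s i<n)))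

  record Unit (x : ℚ) : Set where
    constructor unit
    field
      inverse : ℚ
      integral-unit : Integral x
      integral-inverse : Integral inverse
      inverse-correct : x * inverse ≡ 1ℚ

  inv≡inverse : ∀ {x} (u : Unit x) → inv x ≡ Unit.inverse u
  inv≡inverse {x} (unit y _ _ xy≡1) = inv-unique x y xy≡1

  *-inv : ∀ {x} → Unit x → x * inv x ≡ 1ℚ
  *-inv {x} u = trans (cong (x *_) (inv≡inverse u)) (Unit.inverse-correct u)

  integral-inv : ∀ {x} → Unit x → Integral (inv x)
  integral-inv u = subst Integral (sym (inv≡inverse u)) (Unit.integral-inverse u)

  inv-* : ∀ {x y} → Unit x → Unit y → inv (x * y) ≡ inv x * inv y
  inv-* {x} {y} ux uy = inv-unique (x * y) (inv x * inv y)
    (trans (*-interchange x y (inv x) (inv y)) (cong₂ _*_ (*-inv ux) (*-inv uy)))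

  inv-signQ* : ∀ k {x} → Unit x → inv (signQ k * x) ≡ signQ k * inv x
  inv-signQ* k {x} ux = inv-unique (signQ k * x) (signQ k * inv x)
    (trans (*-interchange (signQ k) x (signQ k) (inv x)) (cong₂ _*_ (signQ-*-signQ k) (*-inv ux)))

  unit-1 : Unit 1ℚ
  unit-1 = unit 1ℚ (integral-ℤ 1) (integral-ℤ 1) refl

  unit-* : ∀ {x y} → Unit x → Unit y → Unit (x * y)
  unit-* {x} {y} (unit x′ ix ix′ xx′≡1) (unit y′ iy iy′ yy′≡1) =
    unit (x′ * y′) (integral-* ix iy) (integral-* ix′ iy′)
         (trans (*-interchange x y x′ y′) (cong₂ _*_ xx′≡1 yy′≡1))

  unit-neg : ∀ {x} → Unit x → Unit (- x)
  unit-neg {x} (unit y ix iy xy≡1) = unit (- y) (integral-neg ix) (integral-neg iy) (trans (neg-*-neg x y) xy≡1)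

  unit-ℕ : ∀ {b} → p ∤ b → Unit (ℕ→ℚ b)
  unit-ℕ {zero} p∤0 = contradiction (p ∣0) p∤0
  unit-ℕ {b@(suc b-1)} p∤b = unit (inv (ℕ→ℚ b)) (integral-ℕ b) (integral b p∤b 1 inv-b*b≡1)
    (trans (ℚ.*-comm (ℕ→ℚ b) _) inv-b*b≡1)
    where
    inv-b*b≡1 : inv (ℕ→ℚ b) * ℕ→ℚ b ≡ 1ℚ
    inv-b*b≡1 = inv-inverseˡ (ℕ→ℚ b) (ℕ→ℚ≢0 b)

  unit-below-p : ∀ {j} → 0 < j → j < p → Unit (ℕ→ℚ j)
  unit-below-p {suc j} _ j<p = unit-ℕ (>⇒∤ j<p)

  unit-rising : ∀ a m → (∀ j → j < m → Unit (a + ℕ→ℚ j)) → Unit (rising a m)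
  unit-rising a zero _ = unit-1
  unit-rising a (suc m) u = unit-* (unit-rising a m (λ j j<m → u j (ℕ.m<n⇒m<1+n j<m))) (u m ℕ.≤-refl)

odd-prime∤2 : ∀ n → Prime (suc (n ℕ.+ n)) → suc (n ℕ.+ n) ∤ 2
odd-prime∤2 zero 1-prime = contradiction 1-prime ¬prime[1]
odd-prime∤2 (suc n) _ = >⇒∤ (s≤s (s≤s (ℕ.≤-trans (s≤s z≤n) (ℕ.m≤n+m (suc n) n))))

module Harmonic (n : ℕ) (p-prime : Prime (suc (n ℕ.+ n))) where

  p : ℕ
  p = suc (n ℕ.+ n)

  open PIntegral p p-prime public

  P : ℚ
  P = ℕ→ℚ p

  p∤2 : p ∤ 2
  p∤2 = odd-prime∤2 n p-prime

  integral-half : Integral half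
  integral-half = integral 2 p∤2 1 refl

  w : ℕ → ℚ
  w j = inv (ℕ→ℚ (suc j))

  H : ℕ → ℚ
  H m = ∑[ j < m ] w j

  H₂ : ℕ → ℚ
  H₂ m = ∑[ j < m ] (w j * w j)

  unit-suc : ∀ {j} → j < n ℕ.+ n → Unit (ℕ→ℚ (suc j))
  unit-suc j<2n = unit-below-p (s≤s z≤n) (s≤s j<2n)

  suc*w≡1 : ∀ {j} → j < n ℕ.+ n → ℕ→ℚ (suc j) * w j ≡ 1ℚ
  suc*w≡1 j<2n = *-inv (unit-suc j<2n)

  integral-w : ∀ {j} → j < n ℕ.+ n → Integral (w j)
  integral-w j<2n = integral-inv (unit-suc j<2n)

  integral-H : ∀ {m} → m ≤ n ℕ.+ n → Integral (H m)
  integral-H {m} m≤2n = integral-∑ m (λ j j<m → integral-w (ℕ.<-≤-trans j<m m≤2n))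

  integral-H₂ : ∀ {m} → m ≤ n ℕ.+ n → Integral (H₂ m)
  integral-H₂ {m} m≤2n = integral-∑ m (λ j j<m → let ij = integral-w (ℕ.<-≤-trans j<m m≤2n) in integral-* ij ij)

  -- Pairing j with 2n - 1 - j, whose denominators j + 1 and 2n - j add up to p.
  harmonic-pairing : p^ 2 ∣ (2 * H (n ℕ.+ n) + P * H₂ (n ℕ.+ n))
  harmonic-pairing = subst (p^ 2 ∣_) (sym paired) (p^∣-∑ (n ℕ.+ n) pair)
    where
    open ≡-Reasoning
    m = n ℕ.+ n
    paired : 2 * H m + P * H₂ m ≡ ∑[ i < m ] (w i + w (m ∸ suc i) + P * (w i * w i))
    paired = begin
      2 * H m + P * H₂ m                                          ≡⟨ cong (_+ P * H₂ m) (double (H m)) ⟩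
      H m + H m + P * H₂ m                                        ≡⟨ cong (λ s → H m + s + P * H₂ m) (∑-reverse w m) ⟩
      H m + ∑[ i < m ] w (m ∸ suc i) + P * H₂ m                   ≡˘⟨ cong₂ _+_ (∑-+ w (λ i → w (m ∸ suc i)) m) (∑-*ˡ P (λ i → w i * w i) m) ⟩
      ∑[ i < m ] (w i + w (m ∸ suc i)) + ∑[ i < m ] (P * (w i * w i)) ≡˘⟨ ∑-+ _ _ m ⟩
      ∑[ i < m ] (w i + w (m ∸ suc i) + P * (w i * w i))          ∎
      where
      double : ∀ h → 2 * h ≡ h + h
      double = solve-∀ ringℚ
    pair : ∀ i → i < m → p^ 2 ∣ (w i + w (m ∸ suc i) + P * (w i * w i))
    pair i i<m = subst (λ k → p^ 2 ∣ (w i + w k + P * (w i * w i))) (sym m∸i≡j)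
                   (subst (p^ 2 ∣_) (sym pair≡) (p^∣-p* (p^∣-p* (integral⇒p^0∣ (integral-* (integral-* wi wi) wj)))))
      where
      j = proj₁ (ℕ.m≤n⇒∃[o]m+o≡n i<m)
      i+j≡m : suc i ℕ.+ j ≡ m
      i+j≡m = proj₂ (ℕ.m≤n⇒∃[o]m+o≡n i<m)
      m∸i≡j : m ∸ suc i ≡ j
      m∸i≡j = trans (cong (_∸ suc i) (sym i+j≡m)) (ℕ.m+n∸m≡n (suc i) j)
      j<m : j < m
      j<m = subst (suc j ≤_) i+j≡m (s≤s (ℕ.m≤n+m j i))
      wi = integral-w i<m
      wj = integral-w j<m
      P≡ : P ≡ ℕ→ℚ (suc i) + ℕ→ℚ (suc j)
      P≡ = trans (cong (ℕ→ℚ ∘ suc) (sym i+j≡m)) (trans (cong ℕ→ℚ (sym (ℕ.+-suc (suc i) j))) (ℕ→ℚ-+ (suc i) (suc j)))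
      sum≡ : w i + w j ≡ P * (w i * w j)
      sum≡ = trans (inverse-sum (ℕ→ℚ (suc i)) (ℕ→ℚ (suc j)) (w i) (w j) (suc*w≡1 i<m) (suc*w≡1 j<m)) (cong (_* (w i * w j)) (sym P≡))
      pair≡ : w i + w j + P * (w i * w i) ≡ P * (P * (w i * w i * w j))
      pair≡ = begin
        w i + w j + P * (w i * w i)            ≡⟨ cong (_+ P * (w i * w i)) sum≡ ⟩
        P * (w i * w j) + P * (w i * w i)      ≡⟨ factor P (w i) (w j) ⟩
        P * (w i * (w i + w j))                ≡⟨ cong (λ s → P * (w i * s)) sum≡ ⟩
        P * (w i * (P * (w i * w j)))          ≡⟨ regroup P (w i) (w j) ⟩
        P * (P * (w i * w i * w j))            ∎
        where
        factor : ∀ P x y → P * (x * y) + P * (x * x) ≡ P * (x * (x + y))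
        factor = solve-∀ ringℚ
        regroup : ∀ P x y → P * (x * (P * (x * y))) ≡ P * (P * (x * x * y))
        regroup = solve-∀ ringℚ

  p∣H : p^ 1 ∣ H (n ℕ.+ n)
  p∣H = subst (p^ 1 ∣_) (sym (halve (H m) (P * H₂ m)))
          (p^∣-*ˡ integral-half (p^∣-sub (p^suc∣⇒p^∣ harmonic-pairing) (p^∣-p* (integral⇒p^0∣ (integral-H₂ ℕ.≤-refl)))))
    where
    m = n ℕ.+ n
    halve : ∀ h r → h ≡ half * (2 * h + r - r)
    halve = solve-∀ ringℚ

  w-odd : ∀ {i} → i < n → w (suc (i ℕ.+ i)) ≡ half * w i
  w-odd {i} i<n = inv-unique (ℕ→ℚ (suc (suc (i ℕ.+ i)))) (half * w i) (begin
    ℕ→ℚ (suc (suc (i ℕ.+ i))) * (half * w i)   ≡˘⟨ cong (λ k → ℕ→ℚ (suc k) * (half * w i)) (ℕ.+-suc i i) ⟩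
    ℕ→ℚ (suc i ℕ.+ suc i) * (half * w i)       ≡⟨ cong (_* (half * w i)) (ℕ→ℚ-+ (suc i) (suc i)) ⟩
    (ℕ→ℚ (suc i) + ℕ→ℚ (suc i)) * (half * w i) ≡⟨ halve (ℕ→ℚ (suc i)) (w i) ⟩
    ℕ→ℚ (suc i) * w i                          ≡⟨ suc*w≡1 (ℕ.<-≤-trans i<n (ℕ.m≤m+n n n)) ⟩
    1ℚ                                         ∎)
    where
    open ≡-Reasoning
    halve : ∀ a x → (a + a) * (half * x) ≡ a * x
    halve = solve-∀ ringℚ

  -- 2(n + i) + 2 = p + (2i + 1), so 1/(2(n+i)+2)² ≡ 1/(2i+1)² mod p.
  quarter-square-shift : ∀ {i} → i < n →
    p^ 1 ∣ ((half * w (n ℕ.+ i)) * (half * w (n ℕ.+ i)) - w (i ℕ.+ i) * w (i ℕ.+ i))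
  quarter-square-shift {i} i<n = subst (p^ 1 ∣_) (sym squares) (p^∣-p* (integral⇒p^0∣ integral-c))
    where
    open ≡-Reasoning
    i+i<2n : i ℕ.+ i < n ℕ.+ n
    i+i<2n = ℕ.+-mono-< i<n i<n
    n+i<2n : n ℕ.+ i < n ℕ.+ n
    n+i<2n = ℕ.+-monoʳ-< n i<n
    a = w (i ℕ.+ i)
    b = half * w (n ℕ.+ i)
    A = ℕ→ℚ (suc (i ℕ.+ i))
    c = - (a * b * (a + b))
    integral-a = integral-w i+i<2n
    integral-b = integral-* integral-half (integral-w n+i<2n)
    integral-c : Integral c
    integral-c = integral-neg (integral-* (integral-* integral-a integral-b) (integral-+ integral-a integral-b))
    p+A≡2[n+i+1] : P + A ≡ ℕ→ℚ (suc (n ℕ.+ i)) + ℕ→ℚ (suc (n ℕ.+ i))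
    p+A≡2[n+i+1] = trans (sym (ℕ→ℚ-+ p (suc (i ℕ.+ i))))
                   (trans (cong ℕ→ℚ (ℕ-identity n i)) (ℕ→ℚ-+ (suc (n ℕ.+ i)) (suc (n ℕ.+ i))))
      where
      ℕ-identity : ∀ n i → suc (n ℕ.+ n) ℕ.+ suc (i ℕ.+ i) ≡ suc (n ℕ.+ i) ℕ.+ suc (n ℕ.+ i)
      ℕ-identity = ℕ-solve-∀
    [P+A]b≡1 : (P + A) * b ≡ 1ℚ
    [P+A]b≡1 = begin
      (P + A) * b                                                              ≡⟨ cong (_* b) p+A≡2[n+i+1] ⟩
      (ℕ→ℚ (suc (n ℕ.+ i)) + ℕ→ℚ (suc (n ℕ.+ i))) * (half * w (n ℕ.+ i))       ≡⟨ halve (ℕ→ℚ (suc (n ℕ.+ i))) (w (n ℕ.+ i)) ⟩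
      ℕ→ℚ (suc (n ℕ.+ i)) * w (n ℕ.+ i)                                        ≡⟨ suc*w≡1 n+i<2n ⟩
      1ℚ                                                                       ∎
      where
      halve : ∀ a x → (a + a) * (half * x) ≡ a * x
      halve = solve-∀ ringℚ
    squares : b * b - a * a ≡ P * c
    squares = begin
      b * b - a * a                          ≡⟨ difference-of-squares a b ⟩
      - ((a - b) * (a + b))                  ≡⟨ cong (λ d → - (d * (a + b))) (inverse-difference A (P + A) a b (suc*w≡1 i+i<2n) [P+A]b≡1) ⟩
      - ((P + A - A) * (a * b) * (a + b))    ≡⟨ regroup P A a b ⟩
      P * c                                  ∎
      where
      difference-of-squares : ∀ a b → b * b - a * a ≡ - ((a - b) * (a + b))
      difference-of-squares = solve-∀ ringℚ
      regroup : ∀ P A a b → - ((P + A - A) * (a * b) * (a + b)) ≡ P * (- (a * b * (a + b)))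
      regroup = solve-∀ ringℚ

  p∣H₂ : p ∤ 3 → p^ 1 ∣ H₂ (n ℕ.+ n)
  p∣H₂ p∤3 = subst (p^ 1 ∣_) (sym recover) (p^∣-*ˡ integral-c quarter-H₂-congruence)
    where
    open ≡-Reasoning
    m = n ℕ.+ n
    sq : ℕ → ℚ
    sq j = w j * w j
    quarter-sq : ℕ → ℚ
    quarter-sq j = (half * w j) * (half * w j)
    quarter-H₂ : ∑< m quarter-sq ≡ half * half * H₂ m
    quarter-H₂ = trans (∑-cong m (λ j _ → regroup (w j))) (∑-*ˡ (half * half) sq m)
      where
      regroup : ∀ x → (half * x) * (half * x) ≡ half * half * (x * x)
      regroup = solve-∀ ringℚ
    low-half : ∑< n quarter-sq ≡ ∑[ i < n ] sq (suc (i ℕ.+ i))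
    low-half = ∑-cong n (λ i i<n → cong₂ _*_ (sym (w-odd i<n)) (sym (w-odd i<n)))
    evens odds shifted : ℚ
    evens = ∑[ i < n ] sq (i ℕ.+ i)
    odds = ∑[ i < n ] sq (suc (i ℕ.+ i))
    shifted = ∑[ i < n ] quarter-sq (n ℕ.+ i)
    difference : half * half * H₂ m - H₂ m ≡ ∑[ i < n ] (quarter-sq (n ℕ.+ i) - sq (i ℕ.+ i))
    difference = begin
      half * half * H₂ m - H₂ m        ≡⟨ cong₂ _-_ (sym quarter-H₂) (∑-evenOdd sq n) ⟩
      ∑< m quarter-sq - (evens + odds) ≡⟨ cong (_- (evens + odds)) (trans (∑-split quarter-sq n n) (cong (_+ shifted) low-half)) ⟩
      odds + shifted - (evens + odds)  ≡⟨ cancel odds shifted evens ⟩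
      shifted + - evens                ≡˘⟨ cong (_+_ shifted) (∑-neg (λ i → sq (i ℕ.+ i)) n) ⟩
      shifted + ∑[ i < n ] (- sq (i ℕ.+ i)) ≡˘⟨ ∑-+ (λ i → quarter-sq (n ℕ.+ i)) (λ i → - sq (i ℕ.+ i)) n ⟩
      ∑[ i < n ] (quarter-sq (n ℕ.+ i) - sq (i ℕ.+ i)) ∎
      where
      cancel : ∀ o h e → o + h - (e + o) ≡ h + - e
      cancel = solve-∀ ringℚ
    quarter-H₂-congruence : p^ 1 ∣ (half * half * H₂ m - H₂ m)
    quarter-H₂-congruence = subst (p^ 1 ∣_) (sym difference) (p^∣-∑ n (λ i i<n → quarter-square-shift i<n))
    t = inv (ℕ→ℚ 3)
    3t≡1 : ℕ→ℚ 3 * t ≡ 1ℚ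
    3t≡1 = *-inv (unit-ℕ p∤3)
    integral-c : Integral (-4 * t)
    integral-c = integral-* (integral-ℤ -4) (integral-inv (unit-ℕ p∤3))
    recover : H₂ m ≡ -4 * t * (half * half * H₂ m - H₂ m)
    recover = begin
      H₂ m                                  ≡⟨ expand (H₂ m) t ⟩
      q + (1ℚ - ℕ→ℚ 3 * t) * H₂ m           ≡⟨ cong (λ s → q + (1ℚ - s) * H₂ m) 3t≡1 ⟩
      q + (1ℚ - 1ℚ) * H₂ m                  ≡⟨ collapse q (H₂ m) ⟩
      q                                     ∎
      where
      q = -4 * t * (half * half * H₂ m - H₂ m)
      expand : ∀ h t → h ≡ -4 * t * (half * half * h - h) + (1ℚ - ℕ→ℚ 3 * t) * h
      expand = solve-∀ ringℚ
      collapse : ∀ x h → x + (1ℚ - 1ℚ) * h ≡ x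
      collapse = solve-∀ ringℚ

base-congruence-identity : ∀ u y → (1ℚ - u) * y ≡ 1ℚ →
  (u + 1ℚ) * (y * y) - (1ℚ + 3 * u) ≡ u * u * ((5 - 3 * u) * (y * y))
base-congruence-identity u y dy≡1 = begin
  (u + 1ℚ) * (y * y) - (1ℚ + 3 * u)                         ≡⟨ expand u y ⟩
  q + (1ℚ + 3 * u) * ((1ℚ - u) * y * ((1ℚ - u) * y) - 1ℚ)   ≡⟨ cong (λ s → q + (1ℚ + 3 * u) * (s * s - 1ℚ)) dy≡1 ⟩
  q + (1ℚ + 3 * u) * (1ℚ * 1ℚ - 1ℚ)                         ≡⟨ collapse q u ⟩
  q                                                         ∎
  where
  open ≡-Reasoning
  q = u * u * ((5 - 3 * u) * (y * y))
  expand : ∀ u y → (u + 1ℚ) * (y * y) - (1ℚ + 3 * u)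
                 ≡ u * u * ((5 - 3 * u) * (y * y)) + (1ℚ + 3 * u) * ((1ℚ - u) * y * ((1ℚ - u) * y) - 1ℚ)
  expand = solve-∀ ringℚ
  collapse : ∀ x u → x + (1ℚ + 3 * u) * (1ℚ * 1ℚ - 1ℚ) ≡ x
  collapse = solve-∀ ringℚ

step-congruence-quotient : ℚ → ℚ → ℚ → ℚ → ℚ
step-congruence-quotient u w v h = 2 * (h + 3 * v) - v - (1ℚ + 2 * w) * (h + 2 * w) - 2 * w - u * (2 * w * (h + 2 * w) + v * (h + 3 * v))

-- Certified by explicit multiples C₁, C₂ of the relations M w = 1 and (1 + M) v = 1.
step-congruence-identity : ∀ u w v h M → M * w ≡ 1ℚ → (1ℚ + M) * v ≡ 1ℚ →
  w * (1ℚ + u * (h + 2 * w)) * ((u + 1ℚ + M) * (1ℚ - (u + u) + (M - 1ℚ)))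
    - v * (1ℚ + u * (h + v + 2 * v)) * ((1ℚ - u + M) * (1ℚ - u + M))
  ≡ u * u * step-congruence-quotient u w v h
step-congruence-identity u w v h M Mw≡1 [1+M]v≡1 = begin
  w * (1ℚ + u * (h + 2 * w)) * ((u + 1ℚ + M) * (1ℚ - (u + u) + (M - 1ℚ)))
    - v * (1ℚ + u * (h + v + 2 * v)) * ((1ℚ - u + M) * (1ℚ - u + M))
      ≡⟨ certificate u w v h M ⟩
  u * u * Q + (M * w - 1ℚ) * C₁ + ((1ℚ + M) * v - 1ℚ) * C₂
      ≡⟨ cong₂ (λ s t → u * u * Q + (s - 1ℚ) * C₁ + (t - 1ℚ) * C₂) Mw≡1 [1+M]v≡1 ⟩
  u * u * Q + (1ℚ - 1ℚ) * C₁ + (1ℚ - 1ℚ) * C₂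
      ≡⟨ collapse (u * u * Q) C₁ C₂ ⟩
  u * u * Q
      ∎
  where
  open ≡-Reasoning
  Q C₁ C₂ : ℚ
  Q = step-congruence-quotient u w v h
  C₁ = (1ℚ + M) * (1ℚ + u * h + 2 * u * w) + u - u * u * (h + 2 * w)
  C₂ = - ((1ℚ + M) * (1ℚ + u * h + 3 * u * v)) - u + 2 * u * u * (h + 3 * v)
  certificate : ∀ u w v h M →
    w * (1ℚ + u * (h + 2 * w)) * ((u + 1ℚ + M) * (1ℚ - (u + u) + (M - 1ℚ)))
      - v * (1ℚ + u * (h + v + 2 * v)) * ((1ℚ - u + M) * (1ℚ - u + M))
    ≡ u * u * (2 * (h + 3 * v) - v - (1ℚ + 2 * w) * (h + 2 * w) - 2 * w - u * (2 * w * (h + 2 * w) + v * (h + 3 * v)))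
      + (M * w - 1ℚ) * ((1ℚ + M) * (1ℚ + u * h + 2 * u * w) + u - u * u * (h + 2 * w))
      + ((1ℚ + M) * v - 1ℚ) * (- ((1ℚ + M) * (1ℚ + u * h + 3 * u * v)) - u + 2 * u * u * (h + 3 * v))
  certificate = solve-∀ ringℚ
  collapse : ∀ x c d → x + (1ℚ - 1ℚ) * c + (1ℚ - 1ℚ) * d ≡ x
  collapse = solve-∀ ringℚ

⌊n+n/2⌋≡n : ∀ n → ⌊ n ℕ.+ n /2⌋ ≡ n
⌊n+n/2⌋≡n zero = refl
⌊n+n/2⌋≡n (suc n) = trans (cong (λ k → ⌊ suc k /2⌋) (ℕ.+-suc n n)) (cong suc (⌊n+n/2⌋≡n n))

module Summand (n : ℕ) (p-prime : Prime (suc (n ℕ.+ n))) where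

  open Harmonic n p-prime public

  u R F : ℚ
  u = P * half
  R = rising half n
  F = rising 1ℚ (n ℕ.+ n)

  half+j≡half*odd : ∀ j → half + ℕ→ℚ j ≡ half * ℕ→ℚ (suc (j ℕ.+ j))
  half+j≡half*odd j = trans (regroup (ℕ→ℚ j))
    (cong (half *_) (sym (trans (ℕ→ℚ-suc (j ℕ.+ j)) (cong (_+_ 1ℚ) (ℕ→ℚ-+ j j)))))
    where
    regroup : ∀ x → half + x ≡ half * (1ℚ + (x + x))
    regroup = solve-∀ ringℚ

  u≡half+n : u ≡ half + ℕ→ℚ n
  u≡half+n = trans (ℚ.*-comm P half) (sym (half+j≡half*odd n))

  unit-half : Unit half
  unit-half = unit 2 integral-half (integral-ℕ 2) refl

  unit-half+j : ∀ {j} → j < n → Unit (half + ℕ→ℚ j)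
  unit-half+j {j} j<n = subst Unit (sym (half+j≡half*odd j))
    (unit-* unit-half (unit-below-p (s≤s z≤n) (s≤s (ℕ.+-mono-< j<n j<n))))

  -- 1 - u + j = ± (half + t) for some t < n, according as j ≥ n or j < n.
  unit-1-u+j : ∀ {j} → j < n ℕ.+ n → Unit (1ℚ - u + ℕ→ℚ j)
  unit-1-u+j {j} j<2n with n ℕ.≤? j
  ... | yes n≤j = subst Unit (sym shift) (unit-half+j t<n)
    where
    t = proj₁ (ℕ.m≤n⇒∃[o]m+o≡n n≤j)
    n+t≡j : n ℕ.+ t ≡ j
    n+t≡j = proj₂ (ℕ.m≤n⇒∃[o]m+o≡n n≤j)
    t<n : t < n
    t<n = ℕ.+-cancelˡ-< n t n (subst (_< n ℕ.+ n) (sym n+t≡j) j<2n)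
    shift : 1ℚ - u + ℕ→ℚ j ≡ half + ℕ→ℚ t
    shift = trans (cong₂ (λ x y → 1ℚ - x + y) u≡half+n (trans (cong ℕ→ℚ (sym n+t≡j)) (ℕ→ℚ-+ n t)))
                  (simplify (ℕ→ℚ n) (ℕ→ℚ t))
      where
      simplify : ∀ x y → 1ℚ - (half + x) + (x + y) ≡ half + y
      simplify = solve-∀ ringℚ
  ... | no n≰j = subst Unit (sym shift) (unit-neg (unit-half+j t<n))
    where
    j<n = ℕ.≰⇒> n≰j
    t = proj₁ (ℕ.m≤n⇒∃[o]m+o≡n j<n)
    j+t≡n : suc j ℕ.+ t ≡ n
    j+t≡n = proj₂ (ℕ.m≤n⇒∃[o]m+o≡n j<n)
    t<n : t < n
    t<n = subst (t <_) j+t≡n (s≤s (ℕ.m≤n+m t j))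
    shift : 1ℚ - u + ℕ→ℚ j ≡ - (half + ℕ→ℚ t)
    shift = trans (cong (λ x → 1ℚ - x + ℕ→ℚ j)
                    (trans u≡half+n (cong (_+_ half) (trans (cong ℕ→ℚ (sym j+t≡n))
                      (trans (ℕ→ℚ-suc (j ℕ.+ t)) (cong (_+_ 1ℚ) (ℕ→ℚ-+ j t)))))))
                  (simplify (ℕ→ℚ j) (ℕ→ℚ t))
      where
      simplify : ∀ x y → 1ℚ - (half + (1ℚ + (x + y))) + x ≡ - (half + y)
      simplify = solve-∀ ringℚ

  A Z Y : ℕ → ℚ
  A i = rising (u + 1ℚ) (suc i)
  Z i = rising (1ℚ - P) i
  Y i = rising (1ℚ - u) (suc i)

  G : ℕ → ℚ
  G i = A i * Z i * (inv (Y i) * inv (Y i))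

  unit-Y : ∀ {i} → i < n ℕ.+ n → Unit (Y i)
  unit-Y {i} i<2n = unit-rising (1ℚ - u) (suc i) (λ j j<1+i → unit-1-u+j (ℕ.<-≤-trans j<1+i i<2n))

  unit-F : Unit F
  unit-F = unit-rising 1ℚ (n ℕ.+ n) (λ j j<2n → subst Unit (ℕ→ℚ-suc j) (unit-suc j<2n))

  B : ℕ → ℚ
  B i = poch half (+ suc n ℤ.- + (2 ℕ.+ i))

  B*Y≡signQ*R : ∀ {i} → i < n ℕ.+ n → B i * Y i ≡ signQ (suc i) * R
  B*Y≡signQ*R {i} i<2n with suc i ℕ.≤? n
  ... | yes i<n = begin
    B i * Y i                                          ≡⟨ cong₂ _*_ B≡ Y≡ ⟩
    rising half a * (signQ (suc i) * X)                ≡⟨ swap (rising half a) (signQ (suc i)) X ⟩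
    signQ (suc i) * (rising half a * X)                ≡˘⟨ cong (signQ (suc i) *_) R≡ ⟩
    signQ (suc i) * R                                  ∎
    where
    open ≡-Reasoning
    a = proj₁ (ℕ.m≤n⇒∃[o]m+o≡n i<n)
    n≡a+1+i : n ≡ a ℕ.+ suc i
    n≡a+1+i = trans (sym (proj₂ (ℕ.m≤n⇒∃[o]m+o≡n i<n))) (ℕ.+-comm (suc i) a)
    X = rising (half + ℕ→ℚ a) (suc i)
    B≡ : B i ≡ rising half a
    B≡ = cong (poch half) (trans (ℤ.m-n≡m⊖n (suc n) (2 ℕ.+ i)) (trans (ℤ.⊖-≥ (s≤s i<n))
           (cong +_ (trans (cong (_∸ suc i) n≡a+1+i) (ℕ.m+n∸n≡m a (suc i))))))
    Y≡ : Y i ≡ signQ (suc i) * X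
    Y≡ = trans (cong (λ x → rising (1ℚ - x) (suc i))
                 (trans u≡half+n (trans (cong (λ k → half + ℕ→ℚ k) n≡a+1+i)
                   (trans (cong (_+_ half) (ℕ→ℚ-+ a (suc i))) (sym (ℚ.+-assoc half (ℕ→ℚ a) (ℕ→ℚ (suc i))))))))
               (rising-reflect (half + ℕ→ℚ a) (suc i))
    R≡ : R ≡ rising half a * X
    R≡ = trans (cong (rising half) n≡a+1+i) (rising-+ half a (suc i))
    swap : ∀ r s x → r * (s * x) ≡ s * (r * x)
    swap = solve-∀ ringℚ
  ... | no i≮n = begin
    B i * Y i                                          ≡⟨ cong₂ _*_ B≡ Y≡ ⟩
    signQ (suc t) * inv X * (signQ n * R * X)          ≡⟨ regroup (signQ (suc t)) (inv X) (signQ n) R X ⟩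
    signQ n * signQ (suc t) * R * (X * inv X)          ≡⟨ cong₂ (λ s y → s * R * y) (sym sign≡) (*-inv unit-X) ⟩
    signQ (suc i) * R * 1ℚ                             ≡⟨ ℚ.*-identityʳ _ ⟩
    signQ (suc i) * R                                  ∎
    where
    open ≡-Reasoning
    n≤i = ℕ.≤-pred (ℕ.≰⇒> i≮n)
    t = proj₁ (ℕ.m≤n⇒∃[o]m+o≡n n≤i)
    n+t≡i : n ℕ.+ t ≡ i
    n+t≡i = proj₂ (ℕ.m≤n⇒∃[o]m+o≡n n≤i)
    1+i≡n+1+t : suc i ≡ n ℕ.+ suc t
    1+i≡n+1+t = trans (cong suc (sym n+t≡i)) (sym (ℕ.+-suc n t))
    t<n : t < n
    t<n = ℕ.+-cancelˡ-< n t n (subst (_< n ℕ.+ n) (sym n+t≡i) i<2n)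
    X = rising half (suc t)
    unit-X : Unit X
    unit-X = unit-rising half (suc t) (λ j j<1+t → unit-half+j (ℕ.<-≤-trans j<1+t t<n))
    B≡ : B i ≡ signQ (suc t) * inv X
    B≡ = trans (cong (poch half) (trans (ℤ.m-n≡m⊖n (suc n) (2 ℕ.+ i)) (trans (ℤ.⊖-< (s≤s (s≤s n≤i)))
                 (cong (ℤ.-_ ∘ +_) (trans (cong (_∸ n) 1+i≡n+1+t) (ℕ.m+n∸m≡n n (suc t)))))))
               (trans (cong inv (fallingBelow≡signQ*rising half (suc t))) (inv-signQ* (suc t) unit-X))
    Y≡ : Y i ≡ signQ n * R * X
    Y≡ = begin
      rising (1ℚ - u) (suc i)                                     ≡⟨ cong (rising (1ℚ - u)) 1+i≡n+1+t ⟩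
      rising (1ℚ - u) (n ℕ.+ suc t)                               ≡⟨ rising-+ (1ℚ - u) n (suc t) ⟩
      rising (1ℚ - u) n * rising (1ℚ - u + ℕ→ℚ n) (suc t)         ≡⟨ cong₂ (λ x y → rising (1ℚ - x) n * rising y (suc t)) u≡half+n
                                                                          (trans (cong (λ x → 1ℚ - x + ℕ→ℚ n) u≡half+n) (simplify (ℕ→ℚ n))) ⟩
      rising (1ℚ - (half + ℕ→ℚ n)) n * X                          ≡⟨ cong (_* X) (rising-reflect half n) ⟩
      signQ n * R * X                                             ∎
      where
      simplify : ∀ x → 1ℚ - (half + x) + x ≡ half
      simplify = solve-∀ ringℚ
    sign≡ : signQ (suc i) ≡ signQ n * signQ (suc t)
    sign≡ = trans (cong signQ 1+i≡n+1+t) (signQ-+ n (suc t))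
    regroup : ∀ s y s′ r x → s * y * (s′ * r * x) ≡ s′ * s * r * (x * y)
    regroup = solve-∀ ringℚ

  B≡signQ*R*invY : ∀ {i} → i < n ℕ.+ n → B i ≡ signQ (suc i) * R * inv (Y i)
  B≡signQ*R*invY {i} i<2n = begin
    B i                          ≡˘⟨ ℚ.*-identityʳ (B i) ⟩
    B i * 1ℚ                     ≡˘⟨ cong (B i *_) (*-inv (unit-Y i<2n)) ⟩
    B i * (Y i * inv (Y i))      ≡˘⟨ ℚ.*-assoc (B i) (Y i) _ ⟩
    B i * Y i * inv (Y i)        ≡⟨ cong (_* inv (Y i)) (B*Y≡signQ*R i<2n) ⟩
    signQ (suc i) * R * inv (Y i) ∎
    where open ≡-Reasoning

  inv-factorial≡ : ∀ {i} → i < n ℕ.+ n → inv (rising 1ℚ (p ℕ.+ 1 ∸ (2 ℕ.+ i))) ≡ signQ i * (Z i * inv F)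
  inv-factorial≡ {i} i<2n = trans (cong (inv ∘ rising 1ℚ) index) (inv-unique (rising 1ℚ b) _ (begin
    rising 1ℚ b * (signQ i * (Z i * inv F))                              ≡⟨ cong (λ z → rising 1ℚ b * (signQ i * (z * inv F))) Z≡ ⟩
    rising 1ℚ b * (signQ i * (signQ i * X * inv F))                      ≡⟨ regroup (rising 1ℚ b) (signQ i) X (inv F) ⟩
    signQ i * signQ i * (rising 1ℚ b * X * inv F)                        ≡⟨ cong₂ (λ s f → s * (f * inv F)) (signQ-*-signQ i) (sym F≡) ⟩
    1ℚ * (F * inv F)                                                     ≡⟨ cong (1ℚ *_) (*-inv unit-F) ⟩
    1ℚ                                                                   ∎))
    where
    open ≡-Reasoning
    o = proj₁ (ℕ.m≤n⇒∃[o]m+o≡n i<2n)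
    b = suc o
    1+i+o≡2n : suc i ℕ.+ o ≡ n ℕ.+ n
    1+i+o≡2n = proj₂ (ℕ.m≤n⇒∃[o]m+o≡n i<2n)
    2n≡b+i : n ℕ.+ n ≡ b ℕ.+ i
    2n≡b+i = trans (sym 1+i+o≡2n) (cong suc (ℕ.+-comm i o))
    index : p ℕ.+ 1 ∸ (2 ℕ.+ i) ≡ b
    index = trans (cong (λ k → suc k ℕ.+ 1 ∸ (2 ℕ.+ i)) (sym 1+i+o≡2n))
                  (trans (cong (_∸ (2 ℕ.+ i)) (ℕ-identity i o)) (ℕ.m+n∸m≡n (2 ℕ.+ i) b))
      where
      ℕ-identity : ∀ i o → suc (suc i ℕ.+ o) ℕ.+ 1 ≡ (2 ℕ.+ i) ℕ.+ suc o
      ℕ-identity = ℕ-solve-∀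
    X = rising (1ℚ + ℕ→ℚ b) i
    F≡ : F ≡ rising 1ℚ b * X
    F≡ = trans (cong (rising 1ℚ) 2n≡b+i) (rising-+ 1ℚ b i)
    P≡ : P ≡ 1ℚ + ℕ→ℚ b + ℕ→ℚ i
    P≡ = trans (ℕ→ℚ-suc (n ℕ.+ n)) (trans (cong (λ k → 1ℚ + ℕ→ℚ k) 2n≡b+i)
           (trans (cong (_+_ 1ℚ) (ℕ→ℚ-+ b i)) (sym (ℚ.+-assoc 1ℚ (ℕ→ℚ b) (ℕ→ℚ i)))))
    Z≡ : Z i ≡ signQ i * X
    Z≡ = trans (cong (λ x → rising (1ℚ - x) i) P≡) (rising-reflect (1ℚ + ℕ→ℚ b) i)
    regroup : ∀ r s x f → r * (s * (s * x * f)) ≡ s * s * (r * x * f)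
    regroup = solve-∀ ringℚ

  K : ℚ
  K = R * R * R * u * inv F

  term≡K*G : ∀ {i} → i < n ℕ.+ n → term p (2 ℕ.+ i) ≡ K * G i
  term≡K*G {i} i<2n = begin
    term p k
      ≡⟨ cong₂ (λ a b → signQ k * (rising half (a ℕ.+ k) * (poch half (+ b ℤ.- + k) * poch half (+ b ℤ.- + k))
                                   * inv (rising 1ℚ (p ℕ.+ 1 ∸ k))))
               (⌊n+n/2⌋≡n n) ⌊p+1/2⌋≡1+n ⟩
    signQ k * (rising half (n ℕ.+ k) * (B i * B i) * inv (rising 1ℚ (p ℕ.+ 1 ∸ k)))
      ≡⟨ cong₂ (λ r s → signQ k * (r * (s * s) * inv (rising 1ℚ (p ℕ.+ 1 ∸ k)))) numerator≡ (B≡signQ*R*invY i<2n) ⟩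
    signQ k * (R * (u * A i) * (signQ (suc i) * R * inv (Y i) * (signQ (suc i) * R * inv (Y i))) * inv (rising 1ℚ (p ℕ.+ 1 ∸ k)))
      ≡⟨ cong (λ f → signQ k * (R * (u * A i) * (signQ (suc i) * R * inv (Y i) * (signQ (suc i) * R * inv (Y i))) * f)) (inv-factorial≡ i<2n) ⟩
    (- (- signQ i)) * (R * (u * A i) * ((- signQ i) * R * inv (Y i) * ((- signQ i) * R * inv (Y i))) * (signQ i * (Z i * inv F)))
      ≡⟨ regroup (signQ i) R u (A i) (inv (Y i)) (Z i) (inv F) ⟩
    (signQ i * signQ i) * (signQ i * signQ i) * (K * G i)
      ≡⟨ cong (λ s → s * s * (K * G i)) (signQ-*-signQ i) ⟩
    1ℚ * 1ℚ * (K * G i)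
      ≡⟨ ℚ.*-identityˡ _ ⟩
    K * G i
      ∎
    where
    open ≡-Reasoning
    k = 2 ℕ.+ i
    ⌊p+1/2⌋≡1+n : ⌊ (p ℕ.+ 1) /2⌋ ≡ suc n
    ⌊p+1/2⌋≡1+n = trans (cong ⌊_/2⌋ (trans (ℕ.+-comm p 1) (cong suc (sym (ℕ.+-suc n n))))) (⌊n+n/2⌋≡n (suc n))
    numerator≡ : rising half (n ℕ.+ k) ≡ R * (u * A i)
    numerator≡ = trans (rising-+ half n k)
      (cong (R *_) (trans (cong (λ x → rising x k) (sym u≡half+n)) (rising-suc u (suc i))))
    regroup : ∀ s R u A y Z f → (- (- s)) * (R * (u * A) * ((- s) * R * y * ((- s) * R * y)) * (s * (Z * f)))
                              ≡ (s * s) * (s * s) * (R * R * R * u * f * (A * Z * (y * y)))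
    regroup = solve-∀ ringℚ

  a : ℕ → ℚ
  a i = w i * (1ℚ + u * (H (suc i) + 2 * w i))

  integral-u : Integral u
  integral-u = integral-* (integral-ℕ p) integral-half

  p²∣u*u* : ∀ {x} → Integral x → p^ 2 ∣ (u * u * x)
  p²∣u*u* {x} ix = subst (p^ 2 ∣_) (regroup P x)
    (p^∣-p* (p^∣-p* (integral⇒p^0∣ (integral-* (integral-* integral-half integral-half) ix))))
    where
    regroup : ∀ P x → P * (P * (half * half * x)) ≡ P * half * (P * half) * x
    regroup = solve-∀ ringℚ

  G≡a-base : 0 < n ℕ.+ n → p^ 2 ∣ (G 0 - a 0)
  G≡a-base 0<2n = subst (p^ 2 ∣_) (sym G₀-a₀) (p²∣u*u* integral-quotient)
    where
    y = inv (Y 0)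
    [1-u]y≡1 : (1ℚ - u) * y ≡ 1ℚ
    [1-u]y≡1 = trans (pad u y) (*-inv (unit-Y 0<2n))
      where
      pad : ∀ u y → (1ℚ - u) * y ≡ 1ℚ * (1ℚ - u + 0ℚ) * y
      pad = solve-∀ ringℚ
    G₀-a₀ : G 0 - a 0 ≡ u * u * ((5 - 3 * u) * (y * y))
    G₀-a₀ = trans (simplify u y) (base-congruence-identity u y [1-u]y≡1)
      where
      simplify : ∀ u y → 1ℚ * (u + 1ℚ + 0ℚ) * 1ℚ * (y * y) - 1ℚ * (1ℚ + u * ((1ℚ + 0ℚ) + 2 * 1ℚ))
                       ≡ (u + 1ℚ) * (y * y) - (1ℚ + 3 * u)
      simplify = solve-∀ ringℚ
    integral-quotient : Integral ((5 - 3 * u) * (y * y))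
    integral-quotient = integral-* (integral-sub (integral-ℤ 5) (integral-* (integral-ℤ 3) integral-u)) (integral-* iy iy)
      where iy = integral-inv (unit-Y 0<2n)

  num den : ℕ → ℚ
  num i = (u + 1ℚ + ℕ→ℚ (suc i)) * (1ℚ - P + ℕ→ℚ i)
  den i = 1ℚ - u + ℕ→ℚ (suc i)

  G-suc : ∀ {i} → suc i < n ℕ.+ n → G (suc i) ≡ G i * num i * (inv (den i) * inv (den i))
  G-suc {i} 1+i<2n =
    trans (cong (λ y → A (suc i) * Z (suc i) * (y * y)) (inv-* (unit-Y (ℕ.<-trans (ℕ.n<1+n i) 1+i<2n)) (unit-1-u+j 1+i<2n)))
          (regroup (A i) (u + 1ℚ + ℕ→ℚ (suc i)) (Z i) (1ℚ - P + ℕ→ℚ i) (inv (Y i)) (inv (den i)))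
    where
    regroup : ∀ r x z y c d → r * x * (z * y) * (c * d * (c * d)) ≡ r * z * (c * c) * (x * y) * (d * d)
    regroup = solve-∀ ringℚ

  a-step : ∀ {i} → suc i < n ℕ.+ n → p^ 2 ∣ (a i * num i - a (suc i) * (den i * den i))
  a-step {i} 1+i<2n = subst (p^ 2 ∣_) (sym (begin
    a i * num i - a (suc i) * (den i * den i)
      ≡⟨ cong₂ (λ x y → a i * ((u + 1ℚ + M) * (1ℚ - x + y)) - w (suc i) * (1ℚ + u * (h′ + 2 * w (suc i))) * (den i * den i))
               P≡u+u ℕ→ℚ-i≡M-1 ⟩
    a i * ((u + 1ℚ + M) * (1ℚ - (u + u) + (M - 1ℚ))) - w (suc i) * (1ℚ + u * (h′ + 2 * w (suc i))) * (den i * den i)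
      ≡⟨ cong (λ s → a i * ((u + 1ℚ + M) * (1ℚ - (u + u) + (M - 1ℚ))) - w (suc i) * (1ℚ + u * (s + 2 * w (suc i))) * (den i * den i))
              (∑-last w (suc i)) ⟩
    a i * ((u + 1ℚ + M) * (1ℚ - (u + u) + (M - 1ℚ))) - w (suc i) * (1ℚ + u * (H (suc i) + w (suc i) + 2 * w (suc i))) * (den i * den i)
      ≡⟨ step-congruence-identity u (w i) (w (suc i)) (H (suc i)) M (suc*w≡1 i<2n) [1+M]v≡1 ⟩
    u * u * step-congruence-quotient u (w i) (w (suc i)) (H (suc i))
      ∎)) (p²∣u*u* integral-quotient)
    where
    open ≡-Reasoning
    i<2n = ℕ.<-trans (ℕ.n<1+n i) 1+i<2n
    M = ℕ→ℚ (suc i)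
    h′ = H (suc (suc i))
    P≡u+u : P ≡ u + u
    P≡u+u = halves P
      where
      halves : ∀ P → P ≡ P * half + P * half
      halves = solve-∀ ringℚ
    ℕ→ℚ-i≡M-1 : ℕ→ℚ i ≡ M - 1ℚ
    ℕ→ℚ-i≡M-1 = trans (cancel (ℕ→ℚ i)) (cong (_- 1ℚ) (sym (ℕ→ℚ-suc i)))
      where
      cancel : ∀ x → x ≡ 1ℚ + x - 1ℚ
      cancel = solve-∀ ringℚ
    [1+M]v≡1 : (1ℚ + M) * w (suc i) ≡ 1ℚ
    [1+M]v≡1 = trans (cong (_* w (suc i)) (sym (ℕ→ℚ-suc (suc i)))) (suc*w≡1 1+i<2n)
    integral-quotient : Integral (step-congruence-quotient u (w i) (w (suc i)) (H (suc i)))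
    integral-quotient =
      integral-sub (integral-sub (integral-sub (integral-sub (integral-* two h+3v) iv) (integral-* (integral-+ one (integral-* two iw)) h+2w))
                                         (integral-* two iw))
                 (integral-* integral-u (integral-+ (integral-* (integral-* two iw) h+2w) (integral-* iv h+3v)))
      where
      one = integral-ℤ 1
      two = integral-ℤ 2
      iw = integral-w i<2n
      iv = integral-w 1+i<2n
      ih = integral-H (ℕ.<⇒≤ 1+i<2n)
      h+2w = integral-+ ih (integral-* two iw)
      h+3v = integral-+ ih (integral-* (integral-ℤ 3) iv)

  G≡a : ∀ i → i < n ℕ.+ n → p^ 2 ∣ (G i - a i)
  G≡a zero 0<2n = G≡a-base 0<2n
  G≡a (suc i) 1+i<2n = subst (p^ 2 ∣_) (sym decompose)
    (p^∣-+ (p^∣-*ʳ integral-ratio (G≡a i i<2n)) (p^∣-*ʳ (integral-* iy iy) (a-step 1+i<2n)))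
    where
    open ≡-Reasoning
    i<2n = ℕ.<-trans (ℕ.n<1+n i) 1+i<2n
    d = den i
    y = inv d
    iy = integral-inv (unit-1-u+j 1+i<2n)
    integral-ratio : Integral (num i * (y * y))
    integral-ratio = integral-* (integral-* (integral-+ (integral-+ integral-u (integral-ℤ 1)) (integral-ℕ (suc i)))
                                            (integral-+ (integral-sub (integral-ℤ 1) (integral-ℕ p)) (integral-ℕ i)))
                                (integral-* iy iy)
    decompose : G (suc i) - a (suc i) ≡ (G i - a i) * (num i * (y * y)) + (a i * num i - a (suc i) * (d * d)) * (y * y)
    decompose = begin
      G (suc i) - a (suc i)
        ≡⟨ cong (_- a (suc i)) (G-suc 1+i<2n) ⟩
      G i * num i * (y * y) - a (suc i)
        ≡⟨ expand (G i) (a i) (num i) (a (suc i)) d y ⟩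
      (G i - a i) * (num i * (y * y)) + (a i * num i - a (suc i) * (d * d)) * (y * y) + a (suc i) * (d * y * (d * y) - 1ℚ)
        ≡⟨ cong (λ s → (G i - a i) * (num i * (y * y)) + (a i * num i - a (suc i) * (d * d)) * (y * y) + a (suc i) * (s * s - 1ℚ))
                (*-inv (unit-1-u+j 1+i<2n)) ⟩
      (G i - a i) * (num i * (y * y)) + (a i * num i - a (suc i) * (d * d)) * (y * y) + a (suc i) * (1ℚ * 1ℚ - 1ℚ)
        ≡⟨ collapse _ (a (suc i)) ⟩
      (G i - a i) * (num i * (y * y)) + (a i * num i - a (suc i) * (d * d)) * (y * y)
        ∎
      where
      expand : ∀ g a r a′ d y → g * r * (y * y) - a′
                              ≡ (g - a) * (r * (y * y)) + (a * r - a′ * (d * d)) * (y * y) + a′ * (d * y * (d * y) - 1ℚ)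
      expand = solve-∀ ringℚ
      collapse : ∀ x a′ → x + a′ * (1ℚ * 1ℚ - 1ℚ) ≡ x
      collapse = solve-∀ ringℚ

  ∑a≡ : ∀ m → ∑< m a ≡ H m + u * half * (H m * H m + H₂ m) + 2 * u * H₂ m
  ∑a≡ m = begin
    ∑< m a
      ≡⟨ ∑-cong m (λ i _ → expand (w i) u (H (suc i))) ⟩
    ∑[ i < m ] (w i + u * (w i * H (suc i)) + 2 * u * (w i * w i))
      ≡⟨ ∑-+ (λ i → w i + u * (w i * H (suc i))) (λ i → 2 * u * (w i * w i)) m ⟩
    ∑[ i < m ] (w i + u * (w i * H (suc i))) + ∑[ i < m ] (2 * u * (w i * w i))
      ≡⟨ cong₂ _+_ (∑-+ w (λ i → u * (w i * H (suc i))) m) (∑-*ˡ (2 * u) (λ i → w i * w i) m) ⟩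
    H m + ∑[ i < m ] (u * (w i * H (suc i))) + 2 * u * H₂ m
      ≡⟨ cong (λ s → H m + s + 2 * u * H₂ m) (∑-*ˡ u (λ i → w i * H (suc i)) m) ⟩
    H m + u * ∑[ i < m ] (w i * H (suc i)) + 2 * u * H₂ m
      ≡⟨ cong (λ s → H m + s + 2 * u * H₂ m) (halve u (∑[ i < m ] (w i * H (suc i)))) ⟩
    H m + u * half * (2 * ∑[ i < m ] (w i * H (suc i))) + 2 * u * H₂ m
      ≡⟨ cong (λ s → H m + u * half * s + 2 * u * H₂ m) (∑-square w m) ⟩
    H m + u * half * (H m * H m + H₂ m) + 2 * u * H₂ m
      ∎
    where
    open ≡-Reasoning
    expand : ∀ w u h → w * (1ℚ + u * (h + 2 * w)) ≡ w + u * (w * h) + 2 * u * (w * w)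
    expand = solve-∀ ringℚ
    halve : ∀ u s → u * s ≡ u * half * (2 * s)
    halve = solve-∀ ringℚ

  p²∣∑a : p ∤ 3 → p^ 2 ∣ ∑< (n ℕ.+ n) a
  p²∣∑a p∤3 = subst (p^ 2 ∣_) (sym (trans (∑a≡ m) (regroup P (H m) (H₂ m))))
    (p^∣-+ (p^∣-+ (p^∣-*ˡ integral-half harmonic-pairing)
                  (p^∣-*ˡ (integral-* (integral-ℤ 3) (integral-* integral-half integral-half)) (p^∣-p* (p∣H₂ p∤3))))
           (p^∣-*ˡ (integral-* integral-half integral-half) (p^∣-p* (p^∣-*ʳ (integral-H ℕ.≤-refl) p∣H))))
    where
    m = n ℕ.+ n
    regroup : ∀ P h h₂ → h + P * half * half * (h * h + h₂) + 2 * (P * half) * h₂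
                       ≡ half * (2 * h + P * h₂) + 3 * (half * half) * (P * h₂) + half * half * (P * (h * h))
    regroup = solve-∀ ringℚ

  p²∣∑G : p ∤ 3 → p^ 2 ∣ ∑< (n ℕ.+ n) G
  p²∣∑G p∤3 = subst (p^ 2 ∣_) (sym (trans (∑-cong m (λ i _ → split (G i) (a i))) (∑-+ a (λ i → G i - a i) m)))
    (p^∣-+ (p²∣∑a p∤3) (p^∣-∑ m G≡a))
    where
    m = n ℕ.+ n
    split : ∀ g a → g ≡ a + (g - a)
    split = solve-∀ ringℚ

  p³∣sum : p ∤ 3 → p^ 3 ∣ sumFromTo 2 p (term p)
  p³∣sum p∤3 = subst (p^ 3 ∣_) (sym sum≡) (p^∣-p* (p^∣-*ˡ integral-c (p²∣∑G p∤3)))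
    where
    open ≡-Reasoning
    m = n ℕ.+ n
    c = R * R * R * half * inv F
    integral-R : Integral R
    integral-R = Unit.integral-unit (unit-rising half n (λ j j<n → unit-half+j j<n))
    integral-c : Integral c
    integral-c = integral-* (integral-* (integral-* (integral-* integral-R integral-R) integral-R) integral-half) (integral-inv unit-F)
    sum≡ : sumFromTo 2 p (term p) ≡ P * (c * ∑< m G)
    sum≡ = begin
      sumFromTo 2 p (term p)          ≡⟨ sumFromTo≡∑ 2 p (term p) ⟩
      ∑[ i < m ] term p (2 ℕ.+ i)     ≡⟨ ∑-cong m (λ i i<m → term≡K*G i<m) ⟩
      ∑[ i < m ] (K * G i)            ≡⟨ ∑-*ˡ K G m ⟩
      K * ∑< m G                      ≡⟨ regroup P R (inv F) (∑< m G) ⟩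
      P * (c * ∑< m G)                ∎
      where
      regroup : ∀ P R f s → R * R * R * (P * half) * f * s ≡ P * (R * R * R * half * f * s)
      regroup = solve-∀ ringℚ

p^∣⇒≡0-mod : ∀ q (q+1-prime : Prime (suc q)) {k x} → PIntegral.p^_∣_ (suc q) q+1-prime k x → x ≡ 0ℚ mod suc q ^ k
p^∣⇒≡0-mod q q+1-prime {k} {x} (PIntegral.multiple z iz x≡) =
  PIntegral.integral⇒p∤↧ (suc q) q+1-prime (subst (PIntegral.Integral (suc q) q+1-prime) (sym scaled≡z) iz)
  where
  open ≡-Reasoning
  m = suc q ^ k
  instance
    m≢0 : ℕ.NonZero m
    m≢0 = ℕ.m^n≢0 (suc q) k
  scaled≡z : (x - 0ℚ) * ((+ 1) / m) ≡ z
  scaled≡z = begin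
    (x - 0ℚ) * ((+ 1) / m)                 ≡⟨ cong₂ (λ s t → (s - 0ℚ) * t) x≡ (1/n≡inv m) ⟩
    (ℕ→ℚ m * z - 0ℚ) * inv (ℕ→ℚ m)         ≡⟨ regroup (ℕ→ℚ m) z (inv (ℕ→ℚ m)) ⟩
    z * (inv (ℕ→ℚ m) * ℕ→ℚ m)              ≡⟨ cong (z *_) (inv-inverseˡ (ℕ→ℚ m) (ℕ→ℚ≢0 m)) ⟩
    z * 1ℚ                                 ≡⟨ ℚ.*-identityʳ z ⟩
    z                                      ∎
    where
    regroup : ∀ M z i → (M * z - 0ℚ) * i ≡ z * (i * M)
    regroup = solve-∀ ringℚ

even-or-odd : ∀ m → ∃ (λ n → m ≡ n ℕ.+ n) ⊎ ∃ (λ n → m ≡ suc (n ℕ.+ n))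
even-or-odd zero = inj₁ (0 , refl)
even-or-odd (suc m) with even-or-odd m
... | inj₁ (n , m≡2n) = inj₂ (n , cong suc m≡2n)
... | inj₂ (n , m≡2n+1) = inj₁ (suc n , trans (cong suc m≡2n+1) (cong suc (sym (ℕ.+-suc n n))))

lemma2p2 : (p : ℕ) → Prime p → p ≢ 2 →
    sumFromTo 2 p (term p) ≡ 0ℚ mod p ^ 3
lemma2p2 p p-prime p≢2 with even-or-odd p
... | inj₁ (n , refl) with prime⇒irreducible p-prime 2∣n+n
  where
  2∣n+n : 2 ∣ n ℕ.+ n
  2∣n+n = divides n (sym (trans (ℕ.*-comm n 2) (cong (n ℕ.+_) (ℕ.+-identityʳ n))))
...   | inj₁ ()
...   | inj₂ 2≡p = contradiction (sym 2≡p) p≢2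
lemma2p2 p p-prime p≢2 | inj₂ (zero , refl) = contradiction p-prime ¬prime[1]
lemma2p2 p p-prime p≢2 | inj₂ (suc zero , refl) = toWitnessFalse {a? = 3 ∣? _} tt
lemma2p2 p p-prime p≢2 | inj₂ (n@(suc (suc k)) , refl) =
  p^∣⇒≡0-mod (n ℕ.+ n) p-prime (Summand.p³∣sum n p-prime p∤3)
  where
  p∤3 : suc (n ℕ.+ n) ∤ 3
  p∤3 = >⇒∤ (s≤s (s≤s (s≤s (ℕ.≤-trans (s≤s z≤n) (ℕ.m≤n+m (suc (suc k)) k)))))
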